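{- Let $A\subseteq E$ be a fixed nonempty parameter set and let $\mathcal{BSS}(U)_A$ be the collection of all bipolar soft sets over $U$ with parameter set $A$. Then $(\mathcal{BSS}(U)_A,\cap_{\mathcal R},\tilde\cup)=(\mathcal{BSS}(U)_A,\tilde\cap,\cup_{\mathcal R})$ (that is, $\cap_{\mathcal R}=\tilde\cap$ and $\tilde\cup=\cup_{\mathcal R}$ on $\mathcal{BSS}(U)_A$), and this is a bounded distributive lattice with least element $(\Phi,\mathfrak U,A)$ and greatest element $(\mathfrak U,\Phi,A)$.
   Context: Let $U$ be a set and $E$ a set of parameters; for $e\in E$, $\lnot e$ is a formal symbol ("not $e$"), distinct for distinct $e$, and $\lnot A=\{\lnot e:e\in A\}$. A bipolar soft set over $U$ is a triple $(F,G,A)$ with $\emptyset\ne A\subseteq E$, $F:A\to\mathcal P(U)$, $G:\lnot A\to\mathcal P(U)$, $F(e)\cap G(\lnot e)=\emptyset$ for all $e\in A$. $(\Phi,\mathfrak U,A)$ has $\Phi(e)=\emptyset$, $\mathfrak U(\lnot e)=U$ and $(\mathfrak U,\Phi,A)$ has $\mathfrak U(e)=U$, $\Phi(\lnot e)=\emptyset$ for all $e\in A$. Extended union $(F,G,A)\tilde\cup(F_1,G_1,B)=(H,I,A\cup B)$: $H=F$, $I=G$ on $A\setminus B$; $H=F_1$, $I=G_1$ on $B\setminus A$; $H(e)=F(e)\cup F_1(e)$, $I(\lnot e)=G(\lnot e)\cap G_1(\lnot e)$ for $e\in A\cap B$. Extended intersection $\tilde\cap$: same but $H(e)=F(e)\cap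 F_1(e)$, $I(\lnot e)=G(\lnot e)\cup G_1(\lnot e)$ on $A\cap B$. Restricted union (for $A\cap B\ne\emptyset$): $(H,I,A\cap B)$, $H(e)=F(e)\cup F_1(e)$, $I(\lnot e)=G(\lnot e)\cap G_1(\lnot e)$; restricted intersection: $(H,I,A\cap B)$, $H(e)=F(e)\cap F_1(e)$, $I(\lnot e)=G(\lnot e)\cup G_1(\lnot e)$. -}

module Defs where

open import Level using (0ℓ)
open import Data.Product using (Σ; ∃; _×_; _,_; proj₁; proj₂)
open import Data.Sum using (_⊎_; inj₁; inj₂)
open import Data.Empty using (⊥)
open import Relation.Nullary using (¬_)
open import Relation.Unary using (Pred)

_≐_ : {X : Set} → Pred X 0ℓ → Pred X 0ℓ → Set
P ≐ Q = (∀ x → P x → Q x) × (∀ x → Q x → P x)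

infix 4 _≐_

module _ (U E : Set) where

  -- F and G are given as total maps on E (G e stands for G(¬e), the
  -- symbol ¬e being in bijection with e); only their values on A matter.
  record BSS (A : Pred E 0ℓ) : Set₁ where
    constructor bss
    field
      F        : E → Pred U 0ℓ
      G        : E → Pred U 0ℓ
      disjoint : ∀ e → A e → ∀ x → F e x → G e x → ⊥
  open BSS public

  _∪ₚ_ : Pred E 0ℓ → Pred E 0ℓ → Pred E 0ℓ
  (A ∪ₚ B) e = A e ⊎ B e

  _∩ₚ_ : Pred E 0ℓ → Pred E 0ℓ → Pred E 0ℓ
  (A ∩ₚ B) e = A e × B e

  _≈_ : {A B : Pred E 0ℓ} → BSS A → BSS B → Set
  _≈_ {A} {B} X Y =
    (∀ e → (A e → B e) × (B e → A e)) ×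
    (∀ e → A e → (F X e ≐ F Y e) × (G X e ≐ G Y e))

  bottom : (A : Pred E 0ℓ) → BSS A
  bottom A = bss (λ _ _ → ⊥) (λ _ _ → Data.Unit.⊤) (λ _ _ _ ())
    where import Data.Unit

  top : (A : Pred E 0ℓ) → BSS A
  top A = bss (λ _ _ → Data.Unit.⊤) (λ _ _ → ⊥) (λ _ _ _ _ ())
    where import Data.Unit

  extUnion : {A B : Pred E 0ℓ} → BSS A → BSS B → BSS (A ∪ₚ B)
  extUnion {A} {B} X Y = bss H I dis
    where
      H : E → Pred U 0ℓ
      H e x = (A e × ¬ B e × F X e x) ⊎ (B e × ¬ A e × F Y e x)
              ⊎ (A e × B e × (F X e x ⊎ F Y e x))
      I : E → Pred U 0ℓ
      I e x = (A e × ¬ B e × G X e x) ⊎ (B e × ¬ A e × G Y e x)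
              ⊎ (A e × B e × (G X e x × G Y e x))
      dis : ∀ e → (A ∪ₚ B) e → ∀ x → H e x → I e x → ⊥
      dis e _ x (inj₁ (a , _ , f)) (inj₁ (_ , _ , g)) = disjoint X e a x f g
      dis e _ x (inj₁ (_ , nb , _)) (inj₂ (inj₁ (b , _ , _))) = nb b
      dis e _ x (inj₁ (_ , nb , _)) (inj₂ (inj₂ (_ , b , _))) = nb b
      dis e _ x (inj₂ (inj₁ (b , _ , _))) (inj₁ (_ , nb , _)) = nb b
      dis e _ x (inj₂ (inj₁ (b , _ , f))) (inj₂ (inj₁ (_ , _ , g))) = disjoint Y e b x f g
      dis e _ x (inj₂ (inj₁ (_ , na , _))) (inj₂ (inj₂ (a , _ , _))) = na a
      dis e _ x (inj₂ (inj₂ (_ , b , _))) (inj₁ (_ , nb , _)) = nb b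
      dis e _ x (inj₂ (inj₂ (a , _ , _))) (inj₂ (inj₁ (_ , na , _))) = na a
      dis e _ x (inj₂ (inj₂ (a , b , inj₁ f))) (inj₂ (inj₂ (_ , _ , (g , _)))) = disjoint X e a x f g
      dis e _ x (inj₂ (inj₂ (a , b , inj₂ f))) (inj₂ (inj₂ (_ , _ , (_ , g)))) = disjoint Y e b x f g

  extInter : {A B : Pred E 0ℓ} → BSS A → BSS B → BSS (A ∪ₚ B)
  extInter {A} {B} X Y = bss H I dis
    where
      H : E → Pred U 0ℓ
      H e x = (A e × ¬ B e × F X e x) ⊎ (B e × ¬ A e × F Y e x)
              ⊎ (A e × B e × (F X e x × F Y e x))
      I : E → Pred U 0ℓ
      I e x = (A e × ¬ B e × G X e x) ⊎ (B e × ¬ A e × G Y e x)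
              ⊎ (A e × B e × (G X e x ⊎ G Y e x))
      dis : ∀ e → (A ∪ₚ B) e → ∀ x → H e x → I e x → ⊥
      dis e _ x (inj₁ (a , _ , f)) (inj₁ (_ , _ , g)) = disjoint X e a x f g
      dis e _ x (inj₁ (_ , nb , _)) (inj₂ (inj₁ (b , _ , _))) = nb b
      dis e _ x (inj₁ (_ , nb , _)) (inj₂ (inj₂ (_ , b , _))) = nb b
      dis e _ x (inj₂ (inj₁ (b , _ , _))) (inj₁ (_ , nb , _)) = nb b
      dis e _ x (inj₂ (inj₁ (b , _ , f))) (inj₂ (inj₁ (_ , _ , g))) = disjoint Y e b x f g
      dis e _ x (inj₂ (inj₁ (_ , na , _))) (inj₂ (inj₂ (a , _ , _))) = na a
      dis e _ x (inj₂ (inj₂ (_ , b , _))) (inj₁ (_ , nb , _)) = nb b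
      dis e _ x (inj₂ (inj₂ (a , _ , _))) (inj₂ (inj₁ (_ , na , _))) = na a
      dis e _ x (inj₂ (inj₂ (a , b , (f , _)))) (inj₂ (inj₂ (_ , _ , inj₁ g))) = disjoint X e a x f g
      dis e _ x (inj₂ (inj₂ (a , b , (_ , f)))) (inj₂ (inj₂ (_ , _ , inj₂ g))) = disjoint Y e b x f g

  -- Restricted union (the side condition A ∩ B ≠ ∅ is required as an argument).
  resUnion : {A B : Pred E 0ℓ} → ∃ (A ∩ₚ B) → BSS A → BSS B → BSS (A ∩ₚ B)
  resUnion _ X Y = bss (λ e x → F X e x ⊎ F Y e x) (λ e x → G X e x × G Y e x) dis
    where
      dis : ∀ e → _ → ∀ x → F X e x ⊎ F Y e x → G X e x × G Y e x → ⊥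
      dis e (a , b) x (inj₁ f) (g , _) = disjoint X e a x f g
      dis e (a , b) x (inj₂ f) (_ , g) = disjoint Y e b x f g

  resInter : {A B : Pred E 0ℓ} → ∃ (A ∩ₚ B) → BSS A → BSS B → BSS (A ∩ₚ B)
  resInter _ X Y = bss (λ e x → F X e x × F Y e x) (λ e x → G X e x ⊎ G Y e x) dis
    where
      dis : ∀ e → _ → ∀ x → F X e x × F Y e x → G X e x ⊎ G Y e x → ⊥
      dis e (a , b) x (f , _) (inj₁ g) = disjoint X e a x f g
      dis e (a , b) x (_ , f) (inj₂ g) = disjoint Y e b x f g

  reindex : {A B : Pred E 0ℓ} → (∀ e → A e → B e) → BSS B → BSS A
  reindex h X = bss (F X) (G X) (λ e a → disjoint X e (h e a))

  -- The binary operations on BSS(U)_A: results of the operations applied to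
  -- two members of BSS(U)_A have parameter set A ∪ A = A (resp. A ∩ A = A).
  module OnA (A : Pred E 0ℓ) (ne : ∃ A) where
    ∩R : BSS A → BSS A → BSS A
    ∩R X Y = reindex (λ e a → a , a) (resInter (proj₁ ne , proj₂ ne , proj₂ ne) X Y)
    ∪R : BSS A → BSS A → BSS A
    ∪R X Y = reindex (λ e a → a , a) (resUnion (proj₁ ne , proj₂ ne , proj₂ ne) X Y)
    ∩~ : BSS A → BSS A → BSS A
    ∩~ X Y = reindex (λ e a → inj₁ a) (extInter X Y)
    ∪~ : BSS A → BSS A → BSS A
    ∪~ X Y = reindex (λ e a → inj₁ a) (extUnion X Y)

-- A bipolar soft set X over A is determined (up to _≈_) by two
-- subsets of the set of "points" (e , x) with e ∈ A, x ∈ U: the positive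
-- part F X e x and the negative part G X e x.  Union/intersection act on the
-- positive part as ∪/∩ and on the negative part dually as ∩/∪.  Hence the map
--   ⟦_⟧ : BSS(U)_A → Pred Point × Pred Point
-- into the product of the subset lattice and its dual is a lattice
-- monomorphism, and Algebra.Lattice.Morphism.LatticeMonomorphism transports
-- distributivity back along it; bounds are checked in the target as well.
module Submission where

open import Defs hiding (_≐_)
open import Level using (Level; 0ℓ; _⊔_)
open import Data.Product using (Σ; ∃; _×_; _,_; proj₁; proj₂)
open import Data.Product.Relation.Binary.Pointwise.NonDependent
  using (Pointwise; ×-isEquivalence)
open import Data.Sum using (_⊎_; inj₁; inj₂)
open import Data.Empty using (⊥-elim)
open import Data.Unit using (tt)
open import Relation.Nullary using (¬_)
open import Relation.Unary using (Pred; _≐_; _∪_; _∩_; ∅) renaming (U to Full)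
open import Relation.Unary.Algebra using (∪-∩-distributiveLattice)
open import Algebra.Lattice.Bundles using (RawLattice; DistributiveLattice)
open import Algebra.Lattice.Structures using (IsDistributiveLattice)
open import Algebra.Lattice.Morphism.Structures using (module LatticeMorphisms)
import Algebra.Lattice.Properties.DistributiveLattice as DistributiveLatticeProperties
import Algebra.Lattice.Morphism.LatticeMonomorphism as LatticeMonomorphism

module _ {U E : Set} {A B : Pred E 0ℓ} where

  commonBranch : ∀ {e} → A e → B e → {P Q R : Pred U 0ℓ} →
    (λ x → (A e × ¬ B e × P x) ⊎ (B e × ¬ A e × Q x) ⊎ (A e × B e × R x)) ≐ R
  commonBranch a b =
    (λ { (inj₁ (_ , b∉B , _))        → ⊥-elim (b∉B b)
       ; (inj₂ (inj₁ (_ , a∉A , _))) → ⊥-elim (a∉A a)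
       ; (inj₂ (inj₂ (_ , _ , r)))   → r })
    , (λ r → inj₂ (inj₂ (a , b , r)))

  extUnion-common : (X : BSS U E A) (Y : BSS U E B) → ∀ {e} → A e → B e →
    (F (extUnion U E X Y) e ≐ F X e ∪ F Y e) ×
    (G (extUnion U E X Y) e ≐ G X e ∩ G Y e)
  extUnion-common X Y a b = commonBranch a b , commonBranch a b

  extInter-common : (X : BSS U E A) (Y : BSS U E B) → ∀ {e} → A e → B e →
    (F (extInter U E X Y) e ≐ F X e ∩ F Y e) ×
    (G (extInter U E X Y) e ≐ G X e ∪ G Y e)
  extInter-common X Y a b = commonBranch a b , commonBranch a b

×-distributiveLattice : {a b ℓ₁ ℓ₂ : Level} →
  DistributiveLattice a ℓ₁ → DistributiveLattice b ℓ₂ →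
  DistributiveLattice (a ⊔ b) (ℓ₁ ⊔ ℓ₂)
×-distributiveLattice L M = record
  { Carrier = L.Carrier × M.Carrier
  ; _≈_ = Pointwise L._≈_ M._≈_
  ; _∨_ = λ x y → proj₁ x L.∨ proj₁ y , proj₂ x M.∨ proj₂ y
  ; _∧_ = λ x y → proj₁ x L.∧ proj₁ y , proj₂ x M.∧ proj₂ y
  ; isDistributiveLattice = record
    { isLattice = record
      { isEquivalence = ×-isEquivalence L.isEquivalence M.isEquivalence
      ; ∨-comm = λ x y → L.∨-comm _ _ , M.∨-comm _ _
      ; ∨-assoc = λ x y z → L.∨-assoc _ _ _ , M.∨-assoc _ _ _
      ; ∨-cong = λ (p , q) (p′ , q′) → L.∨-cong p p′ , M.∨-cong q q′
      ; ∧-comm = λ x y → L.∧-comm _ _ , M.∧-comm _ _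
      ; ∧-assoc = λ x y z → L.∧-assoc _ _ _ , M.∧-assoc _ _ _
      ; ∧-cong = λ (p , q) (p′ , q′) → L.∧-cong p p′ , M.∧-cong q q′
      ; absorptive = (λ x y → L.∨-absorbs-∧ _ _ , M.∨-absorbs-∧ _ _)
                   , (λ x y → L.∧-absorbs-∨ _ _ , M.∧-absorbs-∨ _ _)
      }
    ; ∨-distrib-∧ = (λ x y z → L.∨-distribˡ-∧ _ _ _ , M.∨-distribˡ-∧ _ _ _)
                  , (λ x y z → L.∨-distribʳ-∧ _ _ _ , M.∨-distribʳ-∧ _ _ _)
    ; ∧-distrib-∨ = (λ x y z → L.∧-distribˡ-∨ _ _ _ , M.∧-distribˡ-∨ _ _ _)
                  , (λ x y z → L.∧-distribʳ-∨ _ _ _ , M.∧-distribʳ-∨ _ _ _)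
    }
  }
  where module L = DistributiveLattice L
        module M = DistributiveLattice M

bipolarLattice : (D : Set) → DistributiveLattice (Level.suc 0ℓ) 0ℓ
bipolarLattice D =
  ×-distributiveLattice subsets (DistributiveLatticeProperties.∧-∨-distributiveLattice subsets)
  where subsets = ∪-∩-distributiveLattice D 0ℓ

module _ (D : Set) where
  open DistributiveLattice (bipolarLattice D) using (_∨_; _∧_) renaming (_≈_ to _≃_)

  bottom-∧-zero : ∀ p → (∅ , Full) ∧ p ≃ (∅ , Full)
  bottom-∧-zero p = (proj₁ , λ ()) , ((λ _ → tt) , inj₁)

  top-∨-zero : ∀ p → (Full , ∅) ∨ p ≃ (Full , ∅)
  top-∨-zero p = ((λ _ → tt) , inj₁) , (proj₁ , λ ())

module Embedding (U E : Set) (A : Pred E 0ℓ) (ne : ∃ A) where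
  open OnA U E A ne

  Point : Set
  Point = Σ E A × U

  open DistributiveLattice (bipolarLattice Point)
    using (rawLattice; refl; sym; trans; _∨_; _∧_)
    renaming (_≈_ to _≃_; isDistributiveLattice to bipolar-isDL) public

  _≋_ : BSS U E A → BSS U E A → Set
  _≋_ = _≈_ U E {A} {A}

  onPoints : (E → Pred U 0ℓ) → Pred Point 0ℓ
  onPoints P ((e , _) , x) = P e x

  onPoints-cong : {P Q : E → Pred U 0ℓ} → (∀ {e} → A e → P e ≐ Q e) →
    onPoints P ≐ onPoints Q
  onPoints-cong P≐Q = (λ {((_ , a) , _)} → proj₁ (P≐Q a))
                    , (λ {((_ , a) , _)} → proj₂ (P≐Q a))

  ⟦_⟧ : BSS U E A → Pred Point 0ℓ × Pred Point 0ℓ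
  ⟦ X ⟧ = onPoints (F X) , onPoints (G X)

  ⟦⟧-cong : ∀ X Y → X ≋ Y → ⟦ X ⟧ ≃ ⟦ Y ⟧
  ⟦⟧-cong X Y (_ , same) =
      onPoints-cong (λ a → implicit (proj₁ (same _ a)))
    , onPoints-cong (λ a → implicit (proj₂ (same _ a)))
    where
    -- Defs states set equality with the element argument explicit.
    implicit : {P Q : Pred U 0ℓ} →
      (∀ x → P x → Q x) × (∀ x → Q x → P x) → P ≐ Q
    implicit (P⊆Q , Q⊆P) = (λ {x} → P⊆Q x) , (λ {x} → Q⊆P x)

  ⟦⟧-injective : ∀ X Y → ⟦ X ⟧ ≃ ⟦ Y ⟧ → X ≋ Y
  ⟦⟧-injective X Y ((F⊆ , F⊇) , (G⊆ , G⊇)) =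
      (λ e → (λ a → a) , (λ a → a))
    , (λ e a → ((λ x → F⊆ {(e , a) , x}) , (λ x → F⊇ {(e , a) , x}))
             , ((λ x → G⊆ {(e , a) , x}) , (λ x → G⊇ {(e , a) , x})))

  ∩R-homo : ∀ X Y → ⟦ ∩R X Y ⟧ ≃ ⟦ X ⟧ ∧ ⟦ Y ⟧
  ∩R-homo X Y = refl

  ∪R-homo : ∀ X Y → ⟦ ∪R X Y ⟧ ≃ ⟦ X ⟧ ∨ ⟦ Y ⟧
  ∪R-homo X Y = refl

  -- Every parameter of A is common to both operands of the extended
  -- operations, so they too act componentwise.
  ∩~-homo : ∀ X Y → ⟦ ∩~ X Y ⟧ ≃ ⟦ X ⟧ ∧ ⟦ Y ⟧
  ∩~-homo X Y = onPoints-cong (λ a → proj₁ (extInter-common X Y a a))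
              , onPoints-cong (λ a → proj₂ (extInter-common X Y a a))

  ∪~-homo : ∀ X Y → ⟦ ∪~ X Y ⟧ ≃ ⟦ X ⟧ ∨ ⟦ Y ⟧
  ∪~-homo X Y = onPoints-cong (λ a → proj₁ (extUnion-common X Y a a))
              , onPoints-cong (λ a → proj₂ (extUnion-common X Y a a))

  BSS-rawLattice : RawLattice (Level.suc 0ℓ) 0ℓ
  BSS-rawLattice = record { Carrier = BSS U E A ; _≈_ = _≋_ ; _∨_ = ∪~ ; _∧_ = ∩R }

  ⟦⟧-isLatticeMonomorphism :
    LatticeMorphisms.IsLatticeMonomorphism BSS-rawLattice rawLattice ⟦_⟧
  ⟦⟧-isLatticeMonomorphism = record
    { isLatticeHomomorphism = record
      { isRelHomomorphism = record { cong = λ {X} {Y} → ⟦⟧-cong X Y }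
      ; ∧-homo = ∩R-homo
      ; ∨-homo = ∪~-homo
      }
    ; injective = λ {X} {Y} → ⟦⟧-injective X Y
    }

mainTheorem9 : (U E : Set) (A : Pred E 0ℓ) (ne : ∃ A) →
    let open OnA U E A ne in
    (∀ X Y → _≈_ U E (∩R X Y) (∩~ X Y)) ×
    (∀ X Y → _≈_ U E (∪~ X Y) (∪R X Y)) ×
    IsDistributiveLattice (_≈_ U E {A} {A}) ∪~ ∩R ×
    (∀ X → _≈_ U E (∩R (bottom U E A) X) (bottom U E A)) ×
    (∀ X → _≈_ U E (∪~ (top U E A) X) (top U E A))
mainTheorem9 U E A ne =
    (λ X Y → ⟦⟧-injective (∩R X Y) (∩~ X Y) (trans (∩R-homo X Y) (sym (∩~-homo X Y))))
  , (λ X Y → ⟦⟧-injective (∪~ X Y) (∪R X Y) (trans (∪~-homo X Y) (sym (∪R-homo X Y))))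
  , LatticeMonomorphism.isDistributiveLattice ⟦⟧-isLatticeMonomorphism bipolar-isDL
  , (λ X → ⟦⟧-injective (∩R (bottom U E A) X) (bottom U E A)
                 (trans (∩R-homo (bottom U E A) X) (bottom-∧-zero Point ⟦ X ⟧)))
  , (λ X → ⟦⟧-injective (∪~ (top U E A) X) (top U E A)
                 (trans (∪~-homo (top U E A) X) (top-∨-zero Point ⟦ X ⟧)))
  where open OnA U E A ne
        open Embedding U E A ne
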